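{- Let $\mathcal{G}=(\mathcal{X},X_0,\Sigma_d,\mathcal{R})$ be a parity recursion scheme, let $\mathcal{Z}$ be a set of variables of type $\mathsf{o}$, let $z'_1,\dots,z'_\ell\notin\mathcal{Z}$ be variables of type $\mathsf{o}$, let $Z:\mathcal{Z}\to D_d$, let $N$ be a term over $(\mathcal{X},\mathcal{Z},\Sigma_d)$ of type $\mathsf{o}^\ell\to\mathsf{o}$, let $L_1,\dots,L_\ell$ be terms over $(\mathcal{X},\mathcal{Z},\Sigma_d)$ of type $\mathsf{o}$, let $T$ be an extended tree over $(\mathcal{Z}\cup\{z'_1,\dots,z'_\ell\},\Sigma_d)$, and let $U_1,\dots,U_\ell$ be extended trees over $(\mathcal{Z},\Sigma_d)$. If $\mathsf{tr}^{\mathsf{t}}_d(Z{\restriction}_r,U_i)=\mathsf{BT}_{\mathcal{G}^\dagger}(\mathsf{tr}_d(\emptyset,Z{\restriction}_r,L_i))$ for all $i\in[\ell]$ and $r\in D_d$, and $\mathsf{tr}^{\mathsf{t}}_d(Z[(z'_1,\dots,z'_\ell)\mapsto A],T)=\mathsf{BT}_{\mathcal{G}^\dagger}(\mathsf{tr}_d(A,Z,N))$ for all $A\in D_d^{[\ell]}$, then $$\mathsf{tr}^{\mathsf{t}}_d(Z,T\langle U_1/z'_1\rangle\cdots\langle U_\ell/z'_\ell\rangle)=\mathsf{BT}_{\mathcal{G}^\dagger}(\mathsf{tr}_d(\emptyset,Z,N\,L_1\,\dots\,L_\ell)).$$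
   Context: Types, terms, recursion schemes: $\mathsf{o}$ and $\alpha\to\beta$ are types (right-associative; $\alpha^m\to\beta$ denotes $m$ copies). Terms over $(\mathcal{X},\mathcal{Y},\Sigma)$ are typed nonterminals, typed variables, node constructors $\langle a,K_1,\dots,K_k\rangle$ of type $\mathsf{o}$ and applications $K\,L$. A recursion scheme $\mathcal{G}=(\mathcal{X},X_0,\Sigma,\mathcal{R})$ has finitely many typed nonterminals, start $X_0$ of type $\mathsf{o}$, and for each $X$ a rule $X\,y_1\dots y_k\to R$ ($\mathsf{tp}(X)=\mathsf{tp}(y_1)\to\dots\to\mathsf{tp}(y_k)\to\mathsf{o}$, $R$ of type $\mathsf{o}$ over $(\mathcal{X},\{y_1,\dots,y_k\},\Sigma)$). $X\,K_1\dots K_k\longrightarrow_\mathcal{G}R[K_1/y_1,\dots,K_k/y_k]$; $\mathsf{BT}_\mathcal{G}(M)$ is, coinductively, $\langle a,\mathsf{BT}_\mathcal{G}(K_1),\dots\rangle$ if $M\longrightarrow^*_\mathcal{G}\langle a,K_1,\dots,K_k\rangle$ and $\langle\omega\rangle$ otherwise. $\Sigma_d=\{\mathrm{Adam},\mathrm{Eve}\}\times\{1,\dots,d\}$, written $\langle\wp,p,\dots\rangle$; a parity recursion scheme has alphabet $\Sigma_d$ and generates from $X_0$ a tree without $\omega$ in which every node has at least one child. Transformation $\mathcal{G}^\dagger$: $D_d=\{1,\dots,d,2d\}$, $[m]=\{1,\dots,m\}$; for $p\in[d]$, $r\in D_d$: $r{\restriction}_p=p+1$ if $p$ odd and $p>r$,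 $p-1$ if $p$ even and $p\ge r$, $r$ otherwise; for functions $Z$ into $D_d$, $Z{\restriction}_p$ is pointwise, $Z[z\mapsto r]$ is an update, and $Z[(z'_1,\dots,z'_\ell)\mapsto A]$ denotes $Z[z'_i\mapsto A(\ell+1-i)\mid i\in[\ell]]$. Each type is uniquely $\alpha_1\to\dots\to\alpha_k\to\mathsf{o}^\ell\to\mathsf{o}$ with $k=0$ or $\alpha_k\ne\mathsf{o}$; its $\mathsf{gar}$ is $\ell$; its $\dagger$ is $(\alpha_1^\dagger)^{|D_d|^{\mathsf{gar}(\alpha_1)}}\to\dots\to(\alpha_k^\dagger)^{|D_d|^{\mathsf{gar}(\alpha_k)}}\to\mathsf{o}$; $\mathsf{gar}(M)=\mathsf{gar}(\mathsf{tp}(M))$. $D_d^S$: functions $S\to D_d$ in a fixed order; $P\,(Q_A)_{A\in D_d^S}$ applies $P$ to all $Q_A$ in order; $\emptyset$ is the unique element of $D_d^\emptyset$. Variables $y^\dagger_A$, nonterminals $X^\dagger_A$ ($A\in D_d^{[\mathsf{gar}]}$) of the $\dagger$-types; extra nonterminals $N_\bot,N_\top$ of type $\mathsf{o}$. For $M$ over $(\mathcal{X},\mathcal{Y},\Sigma_d)$, $A\in D_d^{[\mathsf{gar}(M)]}$, partial $Z:\mathcal{Y}\rightharpoonup D_d$ defined only on type-$\mathsf{o}$ variables: $\mathsf{tr}_d(A,Z,X)=X^\dagger_A$; $\mathsf{tr}_d(A,Z,y)=y^\dagger_A$ for $y\notin\mathrm{dom}(Z)$; $\mathsf{tr}_d(\emptyset,Z,z)=N_\top$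 if $Z(z)$ odd, $N_\bot$ if even; $\mathsf{tr}_d(\emptyset,Z,\langle\wp,p,K_1,\dots,K_k\rangle)=\langle\wp,p,\mathsf{tr}_d(\emptyset,Z{\restriction}_p,K_1),\dots\rangle$; if $\mathsf{tp}(K)=\mathsf{o}^{\ell+1}\to\mathsf{o}$ then $\mathsf{tr}_d(A,Z,K\,L)=\langle\mathrm{Eve},1,K^L_1,\dots,K^L_d,K_{2d}\rangle$ with $K_r=\mathsf{tr}_d(A[\ell+1\mapsto r],Z,K)$ ($r\in D_d$), $K^L_r=\langle\mathrm{Adam},1,K_r,\langle\mathrm{Eve},r,\mathsf{tr}_d(\emptyset,Z{\restriction}_r,L)\rangle\rangle$ ($r\in[d]$); if $\mathsf{tp}(K)=\alpha_1\to\dots\to\alpha_k\to\mathsf{o}^\ell\to\mathsf{o}$ with $k\ge1$, $\alpha_k\ne\mathsf{o}$, then $\mathsf{tr}_d(A,Z,K\,L)=\mathsf{tr}_d(A,Z,K)\,(\mathsf{tr}_d(B,Z,L))_{B\in D_d^{[\mathsf{gar}(L)]}}$. $\mathcal{G}^\dagger$ has, for each rule $X\,y_1\dots y_k\,z_1\dots z_\ell\to R$ ($\ell=\mathsf{gar}(X)$) and $A\in D_d^{[\ell]}$, the rule $X^\dagger_A\,(y^\dagger_{1,B})_B\dots(y^\dagger_{k,B})_B\to\mathsf{tr}_d(\emptyset,[z_i\mapsto A(\ell+1-i)\mid i\in[\ell]],R)$, plus $N_\bot\to\langle\mathrm{Eve},1,N_\bot\rangle$, $N_\top\to\langle\mathrm{Eve},2,N_\top\rangle$;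 start $X^\dagger_{0,\emptyset}$, alphabet $\Sigma_d$. Extended trees over $(\mathcal{Z},\Sigma)$, coinductively: $\langle a,T_1,\dots,T_k\rangle$; a variable $z\in\mathcal{Z}$; or $T\langle U/z\rangle$ with $z\notin\mathcal{Z}$ of type $\mathsf{o}$ (bound), $T$ over $(\mathcal{Z}\cup\{z\},\Sigma)$, $U$ over $(\mathcal{Z},\Sigma)$; identified up to renaming bound variables; $T\langle U_1/z_1\rangle\cdots\langle U_\ell/z_\ell\rangle$ means $(\cdots(T\langle U_1/z_1\rangle)\cdots)\langle U_\ell/z_\ell\rangle$. $\top$ ($\bot$) is the tree with a single infinite branch labelled everywhere $(\mathrm{Eve},2)$ ($(\mathrm{Eve},1)$). $\mathsf{tr}^{\mathsf{t}}_d(Z,T)$ for $Z:\mathcal{Z}\to D_d$ and $T$ over $(\mathcal{Z},\Sigma_d)$, coinductively: $\mathsf{tr}^{\mathsf{t}}_d(Z,z)=\top$ if $Z(z)$ odd, $\bot$ if even; $\mathsf{tr}^{\mathsf{t}}_d(Z,\langle\wp,p,T_1,\dots,T_k\rangle)=\langle\wp,p,\mathsf{tr}^{\mathsf{t}}_d(Z{\restriction}_p,T_1),\dots\rangle$; $\mathsf{tr}^{\mathsf{t}}_d(Z,T\langle U/z\rangle)=\langle\mathrm{Eve},1,T^U_1,\dots,T^U_d,T_{2d}\rangle$ with $T_r=\mathsf{tr}^{\mathsf{t}}_d(Z[z\mapsto r],T)$ ($r\in D_d$), $T^U_r=\langle\mathrm{Adam},1,T_r,\langle\mathrm{Eve},r,\mathsf{tr}^{\mathsf{t}}_d(Z{\restriction}_r,U)\rangle\rangle$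 ($r\in[d]$); and (convention) $\mathsf{tr}^{\mathsf{t}}_d(Z,\langle\omega\rangle)=\langle\omega\rangle$. -}

module Defs where

open import Data.Nat using (ℕ; zero; suc; _≤_; _<_; _*_; _∸_; _<ᵇ_; _≤ᵇ_; _≡ᵇ_)
open import Data.Nat.Properties using () renaming (_≟_ to _≟ℕ_)
open import Data.Fin using (Fin; zero; suc; opposite; fromℕ<)
open import Data.Fin.Properties using () renaming (_≟_ to _≟F_)
open import Data.List using (List; []; _∷_; _++_; map; length; lookup; upTo; allFin; concatMap; zip; reverse)
open import Data.List.Properties using () renaming (≡-dec to ≡-decL)
open import Data.Vec using (Vec)
open import Data.Maybe using (Maybe; just; nothing) renaming (map to mmap)
open import Data.Bool using (Bool; true; false; if_then_else_; _∧_; not)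
open import Data.Product using (Σ; _×_; _,_)
open import Data.Product.Properties using () renaming (≡-dec to ≡-dec×)
open import Data.Sum using (_⊎_; inj₁; inj₂)
open import Data.Sum.Properties using () renaming (≡-dec to ≡-dec⊎)
open import Data.Empty using (⊥)
open import Data.Unit using (⊤)
open import Relation.Nullary using (¬_; yes; no)
open import Relation.Binary.Definitions using (DecidableEquality)
open import Relation.Binary.PropositionalEquality using (_≡_)
open import Relation.Binary.Construct.Closure.ReflexiveTransitive using (Star)

infixr 5 _⇒_
data Ty : Set where
  o   : Ty
  _⇒_ : Ty → Ty → Ty

ords : ℕ → Ty
ords zero    = o
ords (suc m) = o ⇒ ords m

ordArity : Ty → Maybe ℕ
ordArity o             = just 0
ordArity (o ⇒ β)       = mmap suc (ordArity β)
ordArity ((_ ⇒ _) ⇒ _) = nothing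

-- unique decomposition α₁ → … → αₖ → o^ℓ → o  (k = 0 or αₖ ≠ o):
-- hd gives [α₁,…,αₖ], gar gives ℓ
hd : Ty → List Ty
hd o = []
hd (α ⇒ β) with ordArity (α ⇒ β)
... | just _  = []
... | nothing = α ∷ hd β

gar : Ty → ℕ
gar o = 0
gar (α ⇒ β) with ordArity (α ⇒ β)
... | just m  = m
... | nothing = gar β

-- Alphabet Σ_d (priorities as naturals; range 1..d enforced by typing)

data Player : Set where
  Adam Eve : Player

Sym : Set
Sym = Player × ℕ

data Term (N V : Set) : Set where
  nt   : N → Term N V
  var  : V → Term N V
  node : Sym → (k : ℕ) → (Fin k → Term N V) → Term N V
  app  : Term N V → Term N V → Term N V

nodeL : ∀ {N V} → Sym → List (Term N V) → Term N V
nodeL a ts = node a (length ts) (lookup ts)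

apps : ∀ {N V} → Term N V → List (Term N V) → Term N V
apps M []       = M
apps M (L ∷ Ls) = apps (app M L) Ls

subst : ∀ {N P V} → Term N P → (P → Term N V) → Term N V
subst (nt X)       σ = nt X
subst (var y)      σ = σ y
subst (node a k K) σ = node a k (λ i → subst (K i) σ)
subst (app K L)    σ = app (subst K σ) (subst L σ)

data Typed (d : ℕ) {N V : Set} (tN : N → Ty) (tV : V → Ty) : Term N V → Ty → Set where
  t-nt   : ∀ X → Typed d tN tV (nt X) (tN X)
  t-var  : ∀ y → Typed d tN tV (var y) (tV y)
  t-node : ∀ {w p k Ks} → 1 ≤ p → p ≤ d → (∀ i → Typed d tN tV (Ks i) o) →
           Typed d tN tV (node (w , p) k Ks) o
  t-app  : ∀ {K L α β} → Typed d tN tV K (α ⇒ β) → Typed d tN tV L α →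
           Typed d tN tV (app K L) β

infer : ∀ {N V} → (N → Ty) → (V → Ty) → Term N V → Maybe Ty
infer tN tV (nt X)       = just (tN X)
infer tN tV (var y)      = just (tV y)
infer tN tV (node _ _ _) = just o
infer tN tV (app K L) with infer tN tV K
... | just (_ ⇒ β) = just β
... | _            = nothing

-- Generic head-rewriting systems: rule  X p₁ … pₘ → body

record RS : Set₁ where
  field
    NT     : Set
    PV     : NT → Set
    decPV  : (X : NT) → DecidableEquality (PV X)
    params : (X : NT) → List (PV X)
    body   : (X : NT) → Term NT (PV X)

assoc : {P T : Set} → DecidableEquality P → T → List (P × T) → P → T
assoc _≟_ def []             p = def
assoc _≟_ def ((q , t) ∷ xs) p with p ≟ q
... | yes _ = t
... | no  _ = assoc _≟_ def xs p

module Red (R : RS) where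
  open RS R

  data _⟶_ {V : Set} : Term NT V → Term NT V → Set where
    step : (X : NT) (args : List (Term NT V)) → length args ≡ length (params X) →
           apps (nt X) args ⟶ subst (body X) (assoc (decPV X) (nt X) (zip (params X) args))

  _⟶*_ : {V : Set} → Term NT V → Term NT V → Set
  _⟶*_ = Star _⟶_

-- (Possibly infinite) trees, represented by their labelling of paths.
-- A path is a list of child indices (0-based); `none` = no node there.

data Lab : Set where
  none : Lab
  ω    : Lab
  nd   : Sym → ℕ → Lab      -- label and number of children

Tree : Set
Tree = List ℕ → Lab

-- BTat R M π l :  the label of BT_R(M) at path π is l
module _ (R : RS) where
  open RS R
  open Red R

  NoNode : {V : Set} → Term NT V → Set
  NoNode M = ∀ a k Ks → ¬ (M ⟶* node a k Ks)

  data BTat {V : Set} (M : Term NT V) : List ℕ → Lab → Set where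
    at-node  : ∀ {a k Ks} → M ⟶* node a k Ks → BTat M [] (nd a k)
    at-ω     : NoNode M → BTat M [] ω
    at-child : ∀ {a k Ks i π l} → M ⟶* node a k Ks → (i<k : i < k) →
               BTat (Ks (fromℕ< i<k)) π l → BTat M (i ∷ π) l
    at-out   : ∀ {a k Ks i π} → M ⟶* node a k Ks → k ≤ i → BTat M (i ∷ π) none
    at-ωout  : ∀ {i π} → NoNode M → BTat M (i ∷ π) none

  IsBT : {V : Set} → Term NT V → Tree → Set
  IsBT M T = ∀ π → BTat M π (T π)

GoodLab : Lab → Set
GoodLab none     = ⊤
GoodLab ω        = ⊥
GoodLab (nd _ k) = 1 ≤ k

-- Recursion schemes over Σ_d.  Rule  X y₁ … yₖ z₁ … z_ℓ → R  with
-- k = length (hd (tp X)), ℓ = gar (tp X); variable inj₁ j is y_{j+1},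
-- inj₂ i is z_{i+1}.

RVar : Ty → Set
RVar τ = Fin (length (hd τ)) ⊎ Fin (gar τ)

rvarTy : (τ : Ty) → RVar τ → Ty
rvarTy τ (inj₁ j) = lookup (hd τ) j
rvarTy τ (inj₂ _) = o

record Scheme (d : ℕ) : Set where
  field
    n     : ℕ
    tp    : Fin n → Ty
    X₀    : Fin n
    X₀-o  : tp X₀ ≡ o
    rhs   : (X : Fin n) → Term (Fin n) (RVar (tp X))
    rhs-ty : (X : Fin n) → Typed d tp (rvarTy (tp X)) (rhs X) o

schemeRS : ∀ {d} → Scheme d → RS
schemeRS G = record
  { NT = Fin n
  ; PV = λ X → RVar (tp X)
  ; decPV = λ X → ≡-dec⊎ _≟F_ _≟F_
  ; params = λ X → map inj₁ (allFin _) ++ map inj₂ (allFin _)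
  ; body = rhs }
  where open Scheme G

IsParity : ∀ {d} → Scheme d → Set
IsParity G = ∀ π l → BTat (schemeRS G) {⊥} (nt (Scheme.X₀ G)) π l → GoodLab l

-- D_d = {1,…,d,2d} (values as naturals), restriction, enumeration

InD : ℕ → ℕ → Set
InD d r = (1 ≤ r × r ≤ d) ⊎ r ≡ 2 * d

isOdd : ℕ → Bool
isOdd zero    = false
isOdd (suc n) = not (isOdd n)

restr : ℕ → ℕ → ℕ
restr p r =
  if isOdd p ∧ (r <ᵇ p) then suc p
  else if not (isOdd p) ∧ (r ≤ᵇ p) then p ∸ 1
  else r

Dlist : ℕ → List ℕ
Dlist d = map suc (upTo d) ++ (2 * d ∷ [])

-- D_d^{[g]} in fixed order; A is represented as the list [A(1),…,A(g)]
enumD : ℕ → ℕ → List (List ℕ)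
enumD d zero    = [] ∷ []
enumD d (suc g) = concatMap (λ r → map (r ∷_) (enumD d g)) (Dlist d)

at : List ℕ → ℕ → ℕ
at []       _       = 0
at (x ∷ xs) zero    = x
at (x ∷ xs) (suc i) = at xs i

data NT† (N : Set) : Set where
  dag : N → List ℕ → NT† N
  N⊥ N⊤ : NT† N

module _ (d : ℕ) {N V : Set} (tN : N → Ty) (tV : V → Ty) where
  -- tr A Z M : variables y ∉ dom(Z) become y†_A = var (y , A)
  tr : List ℕ → (V → Maybe ℕ) → Term N V → Term (NT† N) (V × List ℕ)
  tr A Z (nt X) = nt (dag X A)
  tr A Z (var y) with Z y
  ... | just v  = if isOdd v then nt N⊤ else nt N⊥
  ... | nothing = var (y , A)
  tr A Z (node (w , p) k Ks) = node (w , p) k (λ i → tr [] (λ y → mmap (restr p) (Z y)) (Ks i))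
  tr A Z (app K L) with infer tN tV K
  ... | just (o ⇒ γ) with ordArity γ
  ...   | just _ =
          nodeL (Eve , 1)
            (map (λ r → nodeL (Adam , 1)
                          (tr (A ++ (r ∷ [])) Z K ∷
                           nodeL (Eve , r) (tr [] (λ y → mmap (restr r) (Z y)) L ∷ []) ∷ []))
                 (map suc (upTo d))
             ++ (tr (A ++ (2 * d ∷ [])) Z K ∷ []))
  ...   | nothing = apps (tr A Z K) (map (λ B → tr B Z L) (enumD d (gar o)))
  tr A Z (app K L) | just ((β₁ ⇒ β₂) ⇒ γ) =
          apps (tr A Z K) (map (λ B → tr B Z L) (enumD d (gar (β₁ ⇒ β₂))))
  tr A Z (app K L) | _ = nt N⊥   -- ill-typed (does not occur)

module _ {d : ℕ} (G : Scheme d) where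
  open Scheme G

  PV† : NT† (Fin n) → Set
  PV† (dag X _) = RVar (tp X) × List ℕ
  PV† N⊥ = ⊥
  PV† N⊤ = ⊥

  -- z_i ↦ A(ℓ+1-i)
  Zrule : (X : Fin n) → List ℕ → RVar (tp X) → Maybe ℕ
  Zrule X A (inj₁ _) = nothing
  Zrule X A (inj₂ i) = just (at (reverse A) (Data.Fin.toℕ i))

  dagRS : RS
  dagRS = record
    { NT = NT† (Fin n)
    ; PV = PV†
    ; decPV = λ { (dag X A) → ≡-dec× (≡-dec⊎ _≟F_ _≟F_) (≡-decL _≟ℕ_) ; N⊥ → λ () ; N⊤ → λ () }
    ; params = λ { (dag X A) → concatMap (λ j → map (λ B → (inj₁ j , B))
                                            (enumD d (gar (lookup (hd (tp X)) j))))
                                         (allFin (length (hd (tp X))))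
                 ; N⊥ → [] ; N⊤ → [] }
    ; body = λ { (dag X A) → tr d tp (rvarTy (tp X)) [] (Zrule X A) (rhs X)
               ; N⊥ → nodeL (Eve , 1) (nt N⊥ ∷ [])
               ; N⊤ → nodeL (Eve , 2) (nt N⊤ ∷ []) } }

-- Extended trees over (V, Σ), represented by their labelling of paths.
-- Bound variables are nameless (de Bruijn): `bvar n` refers to the
-- (n+1)-th enclosing binder, where T⟨U/z⟩ is an `esub` node with child 0
-- = T (in which z is bound) and child 1 = U.

data ELab (V : Set) : Set where
  enone : ELab V
  eω    : ELab V
  enode : Sym → ℕ → ELab V
  fvar  : V → ELab V
  bvar  : ℕ → ELab V
  esub  : ELab V

ETree : Set → Set
ETree V = List ℕ → ELab V

childE : ∀ {V : Set} → ℕ → ETree V → ETree V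
childE i T π = T (i ∷ π)

arityE : ∀ {V : Set} → ELab V → ℕ
arityE (enode _ k) = k
arityE esub        = 2
arityE _           = 0

validE : ∀ {V : Set} → ETree V → List ℕ → Set
validE T []      = ⊤
validE T (i ∷ π) = i < arityE (T []) × validE (childE i T) π

bcount : ∀ {V : Set} → ETree V → List ℕ → ℕ
bcount T [] = 0
bcount T (i ∷ π) with T [] | i
... | esub | zero = suc (bcount (childE i T) π)
... | _    | _    = bcount (childE i T) π

LabOk : ∀ {V : Set} → ℕ → ELab V → ℕ → Set
LabOk d enone b           = ⊥
LabOk d eω b              = ⊤
LabOk d (enode (_ , p) _) b = 1 ≤ p × p ≤ d
LabOk d (fvar _) b        = ⊤
LabOk d (bvar n) b        = n < b
LabOk d esub b            = ⊤

ETOk : ∀ {V : Set} → ℕ → ETree V → Set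
ETOk d T = ∀ π → validE T π → LabOk d (T π) (bcount T π)

mapE : ∀ {V W : Set} → (V → W) → ETree V → ETree W
mapE f T π with T π
... | enone     = enone
... | eω        = eω
... | enode a k = enode a k
... | fvar z    = fvar (f z)
... | bvar n    = bvar n
... | esub      = esub

bindT : ∀ {V : Set} {ℓ} → ETree (V ⊎ Fin (suc ℓ)) → ETree (V ⊎ Fin ℓ)
bindT T π with T π
... | enone     = enone
... | eω        = eω
... | enode a k = enode a k
... | fvar (inj₁ v)       = fvar (inj₁ v)
... | fvar (inj₂ zero)    = bvar (bcount T π)
... | fvar (inj₂ (suc i)) = fvar (inj₂ i)
... | bvar n    = bvar n
... | esub      = esub

sub1 : ∀ {V : Set} {ℓ} → ETree (V ⊎ Fin (suc ℓ)) → ETree V → ETree (V ⊎ Fin ℓ)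
sub1 T U []          = esub
sub1 T U (zero ∷ π)  = bindT T π
sub1 T U (suc zero ∷ π) = mapE inj₁ U π
sub1 T U (suc (suc _) ∷ π) = enone

noFin0 : ∀ {V : Set} → V ⊎ Fin 0 → V
noFin0 (inj₁ v) = v
noFin0 (inj₂ ())

-- T⟨U₁/z'₁⟩⋯⟨U_ℓ/z'_ℓ⟩  where z'ᵢ = inj₂ (i-1)
substs : ∀ {V : Set} ℓ → ETree (V ⊎ Fin ℓ) → (Fin ℓ → ETree V) → ETree V
substs zero    T U = mapE noFin0 T
substs (suc ℓ) T U = substs ℓ (sub1 T (U zero)) (λ i → U (suc i))

-- tr^t_d.  Zf: values of free variables; Zb: values of bound variables
-- (head = innermost binder).

-- ⊤ (c = 2) and ⊥ (c = 1): single branch 0,0,0,… labelled (Eve,c)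
constT : ℕ → Tree
constT c []          = nd (Eve , c) 1
constT c (zero ∷ π)  = constT c π
constT c (suc _ ∷ π) = none

valT : ℕ → Tree
valT v = if isOdd v then constT 2 else constT 1

module _ (d : ℕ) where
  trtB : ∀ {V : Set} → (V → ℕ) → List ℕ → ETree V → Tree
  trtB Zf Zb T [] with T []
  ... | enone     = none
  ... | eω        = ω
  ... | enode a k = nd a k
  ... | fvar z    = valT (Zf z) []
  ... | bvar n    = valT (at Zb n) []
  ... | esub      = nd (Eve , 1) (suc d)
  trtB Zf Zb T (i ∷ π) with T []
  ... | enone     = none
  ... | eω        = none
  ... | enode (w , p) k =
        if i <ᵇ k then trtB (λ y → restr p (Zf y)) (map (restr p) Zb) (childE i T) π else none
  ... | fvar z    = valT (Zf z) (i ∷ π)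
  ... | bvar n    = valT (at Zb n) (i ∷ π)
  ... | esub with i <ᵇ d | i ≡ᵇ d
  ...   | true | _ with π
  ...     | []               = nd (Adam , 1) 2
  ...     | zero ∷ π′        = trtB Zf (suc i ∷ Zb) (childE 0 T) π′
  ...     | suc zero ∷ []    = nd (Eve , suc i) 1
  ...     | suc zero ∷ zero ∷ π″ =
              trtB (λ y → restr (suc i) (Zf y)) (map (restr (suc i)) Zb) (childE 1 T) π″
  ...     | suc zero ∷ suc _ ∷ _ = none
  ...     | suc (suc _) ∷ _  = none
  trtB Zf Zb T (i ∷ π) | esub | false | true  = trtB Zf (2 * d ∷ Zb) (childE 0 T) π
  trtB Zf Zb T (i ∷ π) | esub | false | false = none

  trt : ∀ {V : Set} → (V → ℕ) → ETree V → Tree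
  trt Z T = trtB Z [] T

-- Z[(z'₁,…,z'_ℓ) ↦ A] : z'ᵢ ↦ A(ℓ+1-i)
updZ : ∀ {V : Set} {ℓ} → (V → ℕ) → Vec ℕ ℓ → V ⊎ Fin ℓ → ℕ
updZ Z A (inj₁ v) = Z v
updZ Z A (inj₂ i) = Data.Vec.lookup A (opposite i)

-- Induction on ℓ, peeling off the first argument. For K of type o^(m+1) → o both
-- tr_d(A, Z, K L) and tr^t_d(Z[A], S⟨U/z'₁⟩) are the same two-level Eve/Adam gadget; its
-- subtrees are tr_d(A r, Z, K) against tr^t_d(Z[A r], S), and tr_d(∅, Z↾r, L) against
-- tr^t_d(Z↾r, U). The only non-syntactic fact needed is that binding z'₁ in S, while
-- recording its value r on the stack of bound values, is invisible to tr^t_d.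

module Submission where

open import Defs
open import Data.Nat using (ℕ; zero; suc; _+_; _<_; _≤_; z≤n; s≤s; _<ᵇ_; _≡ᵇ_; _*_)
open import Data.Nat.Properties
  using (+-suc; ≤-refl; m≤n⇒m≤1+n; n<1+n; <ᵇ⇒<; <⇒<ᵇ; ≡ᵇ⇒≡; ≡⇒≡ᵇ; <-irrefl; <-asym; <-cmp)
open import Data.Fin using (Fin; zero; suc; fromℕ<; fromℕ; inject₁; opposite)
open import Data.Sum using (_⊎_; inj₁; inj₂)
open import Data.List using (List; []; _∷_; _++_; map; length; applyUpTo; tabulate)
open import Data.List.Properties using (map-++; length-map)
open import Data.Vec using (Vec; lookup; toList; _∷ʳ_) renaming ([] to []ᵥ; _∷_ to _∷ᵥ_)
open import Data.Vec.Properties using (toList-∷ʳ)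
open import Data.Maybe using (just) renaming (map to mmap)
open import Data.Product using (_×_; _,_)
open import Data.Unit using (⊤; tt)
open import Data.Empty using (⊥-elim)
open import Data.Bool using (Bool; true; false; T; if_then_else_)
open import Function using (id)
open import Relation.Binary.Definitions using (tri<; tri≈; tri>)
open import Relation.Binary.PropositionalEquality
  using (_≡_; refl; sym; trans; cong; cong₂; subst₂; module ≡-Reasoning) renaming (subst to ≡-subst)
open import Relation.Binary.Construct.Closure.ReflexiveTransitive using (ε)

data Shape : Set where
  s-none s-ω s-var s-sub : Shape
  s-node : Sym → ℕ → Shape

shape : ∀ {V : Set} → ELab V → Shape
shape enone       = s-none
shape eω          = s-ω
shape (enode a k) = s-node a k
shape (fvar _)    = s-var
shape (bvar _)    = s-var
shape esub        = s-sub

arity : Shape → ℕ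
arity (s-node _ k) = k
arity s-sub        = 2
arity _            = 0

arityE≡arity∘shape : ∀ {V : Set} (l : ELab V) → arityE l ≡ arity (shape l)
arityE≡arity∘shape enone       = refl
arityE≡arity∘shape eω          = refl
arityE≡arity∘shape (enode _ _) = refl
arityE≡arity∘shape (fvar _)    = refl
arityE≡arity∘shape (bvar _)    = refl
arityE≡arity∘shape esub        = refl

bcountStep : Shape → ℕ → ℕ → ℕ
bcountStep s-sub zero b = suc b
bcountStep _     _    b = b

bcount-∷ : ∀ {V : Set} (T : ETree V) i π →
           bcount T (i ∷ π) ≡ bcountStep (shape (T [])) i (bcount (childE i T) π)
bcount-∷ T i π with T [] | i
... | enone     | _     = refl
... | eω        | _     = refl
... | enode _ _ | _     = refl
... | fvar _    | _     = refl
... | bvar _    | _     = refl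
... | esub      | zero  = refl
... | esub      | suc _ = refl

+-bcountStep : ∀ s i k b → k + bcountStep s i b ≡ bcountStep s i k + b
+-bcountStep s-none       i       k b = refl
+-bcountStep s-ω          i       k b = refl
+-bcountStep s-var        i       k b = refl
+-bcountStep (s-node _ _) i       k b = refl
+-bcountStep s-sub        zero    k b = +-suc k b
+-bcountStep s-sub        (suc i) k b = refl

SameShape : ∀ {V W : Set} → ETree V → ETree W → Set
SameShape S S′ = ∀ π → shape (S′ π) ≡ shape (S π)

bcount-sameShape : ∀ {V W : Set} {S : ETree V} {S′ : ETree W} → SameShape S S′ →
                   ∀ π → bcount S′ π ≡ bcount S π
bcount-sameShape same [] = refl
bcount-sameShape {S = S} {S′} same (i ∷ π) = begin
  bcount S′ (i ∷ π)
    ≡⟨ bcount-∷ S′ i π ⟩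
  bcountStep (shape (S′ [])) i (bcount (childE i S′) π)
    ≡⟨ cong₂ (λ s b → bcountStep s i b) (same []) (bcount-sameShape (λ π → same (i ∷ π)) π) ⟩
  bcountStep (shape (S [])) i (bcount (childE i S) π)
    ≡⟨ sym (bcount-∷ S i π) ⟩
  bcount S (i ∷ π) ∎
  where open ≡-Reasoning

validE-sameShape : ∀ {V W : Set} {S : ETree V} {S′ : ETree W} → SameShape S S′ →
                   ∀ π → validE S′ π → validE S π
validE-sameShape same []      _         = tt
validE-sameShape {S = S} {S′} same (i ∷ π) (i<a , v) =
  ≡-subst (i <_) arity-eq i<a , validE-sameShape (λ π → same (i ∷ π)) π v
  where
  arity-eq : arityE (S′ []) ≡ arityE (S [])
  arity-eq = trans (arityE≡arity∘shape (S′ []))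
               (trans (cong arity (same [])) (sym (arityE≡arity∘shape (S []))))

mapL : ∀ {V W : Set} → (V → W) → ELab V → ELab W
mapL f enone       = enone
mapL f eω          = eω
mapL f (enode a k) = enode a k
mapL f (fvar z)    = fvar (f z)
mapL f (bvar n)    = bvar n
mapL f esub        = esub

bindL : ∀ {V : Set} {m} → ℕ → ELab (V ⊎ Fin (suc m)) → ELab (V ⊎ Fin m)
bindL b enone                 = enone
bindL b eω                    = eω
bindL b (enode a k)           = enode a k
bindL b (fvar (inj₁ v))       = fvar (inj₁ v)
bindL b (fvar (inj₂ zero))    = bvar b
bindL b (fvar (inj₂ (suc i))) = fvar (inj₂ i)
bindL b (bvar n)              = bvar n
bindL b esub                  = esub

mapE≡mapL : ∀ {V W : Set} (f : V → W) (T : ETree V) π → mapE f T π ≡ mapL f (T π)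
mapE≡mapL f T π with T π
... | enone     = refl
... | eω        = refl
... | enode _ _ = refl
... | fvar _    = refl
... | bvar _    = refl
... | esub      = refl

bindT≡bindL : ∀ {V : Set} {m} (T : ETree (V ⊎ Fin (suc m))) π → bindT T π ≡ bindL (bcount T π) (T π)
bindT≡bindL T π with T π
... | enone               = refl
... | eω                  = refl
... | enode _ _           = refl
... | fvar (inj₁ _)       = refl
... | fvar (inj₂ zero)    = refl
... | fvar (inj₂ (suc _)) = refl
... | bvar _              = refl
... | esub                = refl

shape-mapL : ∀ {V W : Set} (f : V → W) (l : ELab V) → shape (mapL f l) ≡ shape l
shape-mapL f enone       = refl
shape-mapL f eω          = refl
shape-mapL f (enode _ _) = refl
shape-mapL f (fvar _)    = refl
shape-mapL f (bvar _)    = refl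
shape-mapL f esub        = refl

shape-bindL : ∀ {V : Set} {m} b (l : ELab (V ⊎ Fin (suc m))) → shape (bindL b l) ≡ shape l
shape-bindL b enone                 = refl
shape-bindL b eω                    = refl
shape-bindL b (enode _ _)           = refl
shape-bindL b (fvar (inj₁ _))       = refl
shape-bindL b (fvar (inj₂ zero))    = refl
shape-bindL b (fvar (inj₂ (suc _))) = refl
shape-bindL b (bvar _)              = refl
shape-bindL b esub                  = refl

mapE-sameShape : ∀ {V W : Set} (f : V → W) (T : ETree V) → SameShape T (mapE f T)
mapE-sameShape f T π = trans (cong shape (mapE≡mapL f T π)) (shape-mapL f (T π))

bindT-sameShape : ∀ {V : Set} {m} (T : ETree (V ⊎ Fin (suc m))) → SameShape T (bindT T)
bindT-sameShape T π = trans (cong shape (bindT≡bindL T π)) (shape-bindL _ (T π))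

BoundBelow : ∀ {V : Set} → ELab V → ℕ → Set
BoundBelow (bvar n) b = n < b
BoundBelow _        b = ⊤

-- k counts the binders enclosing S
Scoped : ∀ {V : Set} → ℕ → ETree V → Set
Scoped k S = ∀ π → validE S π → BoundBelow (S π) (k + bcount S π)

ETOk⇒Scoped : ∀ {V : Set} d (T : ETree V) → ETOk d T → Scoped 0 T
ETOk⇒Scoped d T ok π v with T π | ok π v
... | eω        | _ = tt
... | enode _ _ | _ = tt
... | fvar _    | _ = tt
... | bvar n    | p = p
... | esub      | _ = tt

Scoped-child : ∀ {V : Set} {k} {S : ETree V} → Scoped k S → ∀ {l} → S [] ≡ l →
               ∀ i → i < arityE l → Scoped (bcountStep (shape l) i k) (childE i S)
Scoped-child {k = k} {S} sc refl i i<a π v =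
  ≡-subst (BoundBelow (S (i ∷ π)))
    (trans (cong (k +_) (bcount-∷ S i π)) (+-bcountStep (shape (S [])) i k (bcount (childE i S) π)))
    (sc (i ∷ π) (i<a , v))

BoundBelow-mapL : ∀ {V W : Set} (f : V → W) l {b} → BoundBelow l b → BoundBelow (mapL f l) b
BoundBelow-mapL f enone       _ = tt
BoundBelow-mapL f eω          _ = tt
BoundBelow-mapL f (enode _ _) _ = tt
BoundBelow-mapL f (fvar _)    _ = tt
BoundBelow-mapL f (bvar n)    p = p
BoundBelow-mapL f esub        _ = tt

BoundBelow-bindL : ∀ {V : Set} {m} (l : ELab (V ⊎ Fin (suc m))) {b} → BoundBelow l b →
                   BoundBelow (bindL b l) (suc b)
BoundBelow-bindL enone                 _ = tt
BoundBelow-bindL eω                    _ = tt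
BoundBelow-bindL (enode _ _)           _ = tt
BoundBelow-bindL (fvar (inj₁ _))       _ = tt
BoundBelow-bindL (fvar (inj₂ zero))    _ = ≤-refl
BoundBelow-bindL (fvar (inj₂ (suc _))) _ = tt
BoundBelow-bindL (bvar n)              p = m≤n⇒m≤1+n p
BoundBelow-bindL esub                  _ = tt

Scoped-sub1 : ∀ {V : Set} {m} (S : ETree (V ⊎ Fin (suc m))) (U : ETree V) →
              Scoped 0 S → Scoped 0 U → Scoped 0 (sub1 S U)
Scoped-sub1 S U scS scU [] _ = tt
Scoped-sub1 S U scS scU (zero ∷ π) (_ , v) =
  subst₂ BoundBelow (sym (bindT≡bindL S π)) (cong suc (sym (bcount-sameShape same π)))
    (BoundBelow-bindL (S π) (scS π (validE-sameShape same π v)))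
  where same = bindT-sameShape S
Scoped-sub1 {m = m} S U scS scU (suc zero ∷ π) (_ , v) =
  subst₂ BoundBelow (sym (mapE≡mapL inj₁ U π)) (sym (bcount-sameShape same π))
    (BoundBelow-mapL inj₁ (U π) (scU π (validE-sameShape same π v)))
  where same = mapE-sameShape (inj₁ {B = Fin m}) U
Scoped-sub1 S U scS scU (suc (suc _) ∷ π) (s≤s (s≤s ()) , _)

extend : ∀ {V : Set} {m} → (V ⊎ Fin m → ℕ) → ℕ → V ⊎ Fin (suc m) → ℕ
extend g v (inj₁ x)       = g (inj₁ x)
extend g v (inj₂ zero)    = v
extend g v (inj₂ (suc j)) = g (inj₂ j)

-- The lengths carry + 0 to match k + bcount S [] at a root.
at-++ˡ : ∀ (xs ys : List ℕ) {n} → n < length xs + 0 → at (xs ++ ys) n ≡ at xs n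
at-++ˡ (x ∷ xs) ys {zero}  _         = refl
at-++ˡ (x ∷ xs) ys {suc n} (s≤s n<) = at-++ˡ xs ys n<

at-++-length : ∀ (xs : List ℕ) v → at (xs ++ v ∷ []) (length xs + 0) ≡ v
at-++-length []       v = refl
at-++-length (x ∷ xs) v = at-++-length xs v

module _ (d : ℕ) where

  -- trtB unfolded one level; unlike trtB it computes on a variable label
  trtLabel : ∀ {V : Set} → (V → ℕ) → List ℕ → ELab V → (ℕ → ETree V) → Tree
  trtLabel Zf Zb enone       ch []      = none
  trtLabel Zf Zb eω          ch []      = ω
  trtLabel Zf Zb (enode a k) ch []      = nd a k
  trtLabel Zf Zb (fvar z)    ch []      = valT (Zf z) []
  trtLabel Zf Zb (bvar n)    ch []      = valT (at Zb n) []
  trtLabel Zf Zb esub        ch []      = nd (Eve , 1) (suc d)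
  trtLabel Zf Zb enone       ch (i ∷ π) = none
  trtLabel Zf Zb eω          ch (i ∷ π) = none
  trtLabel Zf Zb (enode (w , p) k) ch (i ∷ π) =
    if i <ᵇ k then trtB d (λ y → restr p (Zf y)) (map (restr p) Zb) (ch i) π else none
  trtLabel Zf Zb (fvar z)    ch (i ∷ π) = valT (Zf z) (i ∷ π)
  trtLabel Zf Zb (bvar n)    ch (i ∷ π) = valT (at Zb n) (i ∷ π)
  trtLabel Zf Zb esub        ch (i ∷ π) = choice (i <ᵇ d) (i ≡ᵇ d) π
    where
    choice : Bool → Bool → List ℕ → Lab
    choice true  _    []                       = nd (Adam , 1) 2
    choice true  _    (zero ∷ π′)              = trtB d Zf (suc i ∷ Zb) (ch 0) π′
    choice true  _    (suc zero ∷ [])          = nd (Eve , suc i) 1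
    choice true  _    (suc zero ∷ zero ∷ π″)   =
      trtB d (λ y → restr (suc i) (Zf y)) (map (restr (suc i)) Zb) (ch 1) π″
    choice true  _    (suc zero ∷ suc _ ∷ _)   = none
    choice true  _    (suc (suc _) ∷ _)        = none
    choice false true  π                       = trtB d Zf (2 * d ∷ Zb) (ch 0) π
    choice false false π                       = none

  trtB-unfold : ∀ {V : Set} (Zf : V → ℕ) Zb (T : ETree V) π →
                trtB d Zf Zb T π ≡ trtLabel Zf Zb (T []) (λ i → childE i T) π
  trtB-unfold Zf Zb T [] with T []
  ... | enone     = refl
  ... | eω        = refl
  ... | enode _ _ = refl
  ... | fvar _    = refl
  ... | bvar _    = refl
  ... | esub      = refl
  trtB-unfold Zf Zb T (i ∷ π) with T []
  ... | enone     = refl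
  ... | eω        = refl
  ... | enode _ _ = refl
  ... | fvar _    = refl
  ... | bvar _    = refl
  ... | esub with i <ᵇ d | i ≡ᵇ d
  ...   | false | true  = refl
  ...   | false | false = refl
  ...   | true  | _ with π
  ...     | []                     = refl
  ...     | zero ∷ _               = refl
  ...     | suc zero ∷ []          = refl
  ...     | suc zero ∷ zero ∷ _    = refl
  ...     | suc zero ∷ suc _ ∷ _   = refl
  ...     | suc (suc _) ∷ _        = refl

  trtB-relabel : ∀ {V W : Set} (f : V → W) (g : W → ℕ) (h : V → ℕ) → (∀ y → g (f y) ≡ h y) →
                 ∀ Zb (S : ETree V) (S′ : ETree W) → (∀ π → S′ π ≡ mapL f (S π)) →
                 ∀ π → trtB d g Zb S′ π ≡ trtB d h Zb S π
  trtB-relabel f g h gf≗h Zb S S′ rel []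
    rewrite trtB-unfold g Zb S′ [] | trtB-unfold h Zb S [] | rel [] with S []
  ... | enone     = refl
  ... | eω        = refl
  ... | enode _ _ = refl
  ... | fvar z    = cong (λ x → valT x []) (gf≗h z)
  ... | bvar _    = refl
  ... | esub      = refl
  trtB-relabel f g h gf≗h Zb S S′ rel (i ∷ π)
    rewrite trtB-unfold g Zb S′ (i ∷ π) | trtB-unfold h Zb S (i ∷ π) | rel [] with S []
  ... | enone     = refl
  ... | eω        = refl
  ... | enode (w , p) k = cong (if i <ᵇ k then_else none)
      (trtB-relabel f _ _ (λ y → cong (restr p) (gf≗h y)) _ (childE i S) (childE i S′) (λ π → rel (i ∷ π)) π)
  ... | fvar z    = cong (λ x → valT x (i ∷ π)) (gf≗h z)
  ... | bvar _    = refl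
  ... | esub with i <ᵇ d | i ≡ᵇ d
  ...   | false | true  = trtB-relabel f g h gf≗h _ (childE 0 S) (childE 0 S′) (λ π → rel (0 ∷ π)) π
  ...   | false | false = refl
  ...   | true  | _ with π
  ...     | []                   = refl
  ...     | zero ∷ π′            = trtB-relabel f g h gf≗h _ (childE 0 S) (childE 0 S′) (λ π → rel (0 ∷ π)) π′
  ...     | suc zero ∷ []        = refl
  ...     | suc zero ∷ zero ∷ π″ =
            trtB-relabel f _ _ (λ y → cong (restr (suc i)) (gf≗h y)) _
              (childE 1 S) (childE 1 S′) (λ π → rel (1 ∷ π)) π″
  ...     | suc zero ∷ suc _ ∷ _ = refl
  ...     | suc (suc _) ∷ _      = refl

BindRel : ∀ {V : Set} {m} → ℕ → ETree (V ⊎ Fin (suc m)) → ETree (V ⊎ Fin m) → Set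
BindRel k S S′ = ∀ π → S′ π ≡ bindL (k + bcount S π) (S π)

BindRel-child : ∀ {V : Set} {m} {k} {S : ETree (V ⊎ Fin (suc m))} {S′} → BindRel k S S′ →
                ∀ {l} → S [] ≡ l → ∀ i → BindRel (bcountStep (shape l) i k) (childE i S) (childE i S′)
BindRel-child {k = k} {S} rel refl i π =
  trans (rel (i ∷ π))
    (cong (λ b → bindL b (S (i ∷ π)))
      (trans (cong (k +_) (bcount-∷ S i π)) (+-bcountStep (shape (S [])) i k (bcount (childE i S) π))))

extend-restr : ∀ {V : Set} {m} p (g : V ⊎ Fin m → ℕ) v y →
               extend (λ y → restr p (g y)) (restr p v) y ≡ restr p (extend g v y)
extend-restr p g v (inj₁ x)       = refl
extend-restr p g v (inj₂ zero)    = refl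
extend-restr p g v (inj₂ (suc j)) = refl

module _ (d : ℕ) where

  -- Turning z'₁ into a bound variable at depth k and pushing its value v below the k bound
  -- values does not change the translation.
  trtB-bind : ∀ {V : Set} {m} (g : V ⊎ Fin m → ℕ) (f : V ⊎ Fin (suc m) → ℕ) v →
              (∀ y → extend g v y ≡ f y) →
              ∀ Zb Zb′ → Zb′ ≡ Zb ++ v ∷ [] → ∀ k → length Zb ≡ k →
              ∀ S S′ → BindRel k S S′ → Scoped k S → ∀ π → trtB d g Zb′ S′ π ≡ trtB d f Zb S π
  trtB-bind-restr : ∀ {V : Set} {m} (g : V ⊎ Fin m → ℕ) (f : V ⊎ Fin (suc m) → ℕ) v →
              (∀ y → extend g v y ≡ f y) →
              ∀ Zb k → length Zb ≡ k → ∀ S S′ → BindRel k S S′ → Scoped k S → ∀ p π →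
              trtB d (λ y → restr p (g y)) (map (restr p) (Zb ++ v ∷ [])) S′ π ≡
              trtB d (λ y → restr p (f y)) (map (restr p) Zb) S π

  trtB-bind-restr g f v ext≗f Zb k len S S′ rel sc p =
    trtB-bind (λ y → restr p (g y)) (λ y → restr p (f y)) (restr p v)
      (λ y → trans (extend-restr p g v y) (cong (restr p) (ext≗f y)))
      (map (restr p) Zb) _ (map-++ (restr p) Zb (v ∷ []))
      k (trans (length-map (restr p) Zb) len) S S′ rel sc

  trtB-bind g f v ext≗f Zb .(Zb ++ v ∷ []) refl .(length Zb) refl S S′ rel sc []
    rewrite trtB-unfold d g (Zb ++ v ∷ []) S′ [] | trtB-unfold d f Zb S [] | rel [] with S [] | sc [] tt
  ... | enone               | _ = refl
  ... | eω                  | _ = refl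
  ... | enode _ _           | _ = refl
  ... | fvar (inj₁ x)       | _ = cong (λ x → valT x []) (ext≗f (inj₁ x))
  ... | fvar (inj₂ zero)    | _ = cong (λ x → valT x []) (trans (at-++-length Zb v) (ext≗f (inj₂ zero)))
  ... | fvar (inj₂ (suc j)) | _ = cong (λ x → valT x []) (ext≗f (inj₂ (suc j)))
  ... | bvar n              | q = cong (λ x → valT x []) (at-++ˡ Zb _ q)
  ... | esub                | _ = refl
  trtB-bind g f v ext≗f Zb .(Zb ++ v ∷ []) refl .(length Zb) refl S S′ rel sc (i ∷ π)
    rewrite trtB-unfold d g (Zb ++ v ∷ []) S′ (i ∷ π) | trtB-unfold d f Zb S (i ∷ π) | rel []
    with S [] in eqS | sc [] tt
  ... | enone               | _ = refl
  ... | eω                  | _ = refl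
  ... | fvar (inj₁ x)       | _ = cong (λ x → valT x (i ∷ π)) (ext≗f (inj₁ x))
  ... | fvar (inj₂ zero)    | _ = cong (λ x → valT x (i ∷ π)) (trans (at-++-length Zb v) (ext≗f (inj₂ zero)))
  ... | fvar (inj₂ (suc j)) | _ = cong (λ x → valT x (i ∷ π)) (ext≗f (inj₂ (suc j)))
  ... | bvar n              | q = cong (λ x → valT x (i ∷ π)) (at-++ˡ Zb _ q)
  ... | enode (w , p) a     | _ with i <ᵇ a in i<ᵇa
  ...   | false = refl
  ...   | true  = trtB-bind-restr g f v ext≗f Zb _ refl (childE i S) (childE i S′) (BindRel-child rel eqS i)
                    (Scoped-child sc eqS i (<ᵇ⇒< i a (≡-subst T (sym i<ᵇa) tt))) p π
  trtB-bind g f v ext≗f Zb _ refl _ refl S S′ rel sc (i ∷ π) | esub | _ with i <ᵇ d | i ≡ᵇ d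
  ...   | false | true  = trtB-bind g f v ext≗f (2 * d ∷ Zb) _ refl _ refl (childE 0 S) (childE 0 S′)
                            (BindRel-child rel eqS 0) (Scoped-child sc eqS 0 (s≤s z≤n)) π
  ...   | false | false = refl
  ...   | true  | _ with π
  ...     | []                   = refl
  ...     | zero ∷ π′            = trtB-bind g f v ext≗f (suc i ∷ Zb) _ refl _ refl (childE 0 S) (childE 0 S′)
                                     (BindRel-child rel eqS 0) (Scoped-child sc eqS 0 (s≤s z≤n)) π′
  ...     | suc zero ∷ []        = refl
  ...     | suc zero ∷ zero ∷ π″ = trtB-bind-restr g f v ext≗f Zb _ refl (childE 1 S) (childE 1 S′)
                                     (BindRel-child rel eqS 1) (Scoped-child sc eqS 1 (s≤s (s≤s z≤n))) (suc i) π″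
  ...     | suc zero ∷ suc _ ∷ _ = refl
  ...     | suc (suc _) ∷ _      = refl

lookup-∷ʳ-last : ∀ {X : Set} {m} (A : Vec X m) r → lookup (A ∷ʳ r) (fromℕ m) ≡ r
lookup-∷ʳ-last []ᵥ       r = refl
lookup-∷ʳ-last (x ∷ᵥ A) r = lookup-∷ʳ-last A r

lookup-∷ʳ-inject₁ : ∀ {X : Set} {m} (A : Vec X m) r j → lookup (A ∷ʳ r) (inject₁ j) ≡ lookup A j
lookup-∷ʳ-inject₁ (x ∷ᵥ A) r zero    = refl
lookup-∷ʳ-inject₁ (x ∷ᵥ A) r (suc j) = lookup-∷ʳ-inject₁ A r j

∀-lookup-∷ʳ : ∀ {X : Set} (P : X → Set) {m} (A : Vec X m) r →
              (∀ j → P (lookup A j)) → P r → ∀ j → P (lookup (A ∷ʳ r) j)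
∀-lookup-∷ʳ P []ᵥ       r _  Pr zero    = Pr
∀-lookup-∷ʳ P (x ∷ᵥ A) r PA Pr zero    = PA zero
∀-lookup-∷ʳ P (x ∷ᵥ A) r PA Pr (suc j) = ∀-lookup-∷ʳ P A r (λ j → PA (suc j)) Pr j

-- z'₁ is the variable assigned last: updZ reads A from the end
extend-updZ : ∀ {V : Set} {m} (Z : V → ℕ) (A : Vec ℕ m) r y → extend (updZ Z A) r y ≡ updZ Z (A ∷ʳ r) y
extend-updZ Z A r (inj₁ x)       = refl
extend-updZ Z A r (inj₂ zero)    = sym (lookup-∷ʳ-last A r)
extend-updZ Z A r (inj₂ (suc j)) = sym (lookup-∷ʳ-inject₁ A r (opposite j))

choices : ∀ {X : Set} → (ℕ → X) → X → (ℕ → ℕ) → ℕ → List X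
choices F x g n = map F (map suc (applyUpTo g n)) ++ x ∷ []

length-choices : ∀ {X : Set} (F : ℕ → X) x g n → length (choices F x g n) ≡ suc n
length-choices F x g zero    = refl
length-choices F x g (suc n) = cong suc (length-choices F x (λ k → g (suc k)) n)

lookup-choices-< : ∀ {X : Set} (F : ℕ → X) x g n {i} (q : i < length (choices F x g n)) → i < n →
                   Data.List.lookup (choices F x g n) (fromℕ< q) ≡ F (suc (g i))
lookup-choices-< F x g (suc n) {zero}  (s≤s q) _       = refl
lookup-choices-< F x g (suc n) {suc i} (s≤s q) (s≤s p) = lookup-choices-< F x (λ k → g (suc k)) n q p

lookup-choices-last : ∀ {X : Set} (F : ℕ → X) x g n (q : n < length (choices F x g n)) →
                      Data.List.lookup (choices F x g n) (fromℕ< q) ≡ x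
lookup-choices-last F x g zero    (s≤s z≤n) = refl
lookup-choices-last F x g (suc n) (s≤s q)   = lookup-choices-last F x (λ k → g (suc k)) n q

adamNode : ∀ {N W : Set} → (ℕ → Term N W) → (ℕ → Term N W) → ℕ → Term N W
adamNode Kt Lt r = nodeL (Adam , 1) (Kt r ∷ nodeL (Eve , r) (Lt r ∷ []) ∷ [])

-- the shape of tr_d(A, Z, K L) for K of type o^(ℓ+1) → o, with K_r and tr_d(∅, Z↾r, L) abstracted
gadget : ∀ {N W : Set} → ℕ → (ℕ → Term N W) → (ℕ → Term N W) → Term N W
gadget d Kt Lt = nodeL (Eve , 1) (choices (adamNode Kt Lt) (Kt (2 * d)) id d)

infer-Typed : ∀ {d} {N V : Set} {tN : N → Ty} {tV : V → Ty} {M τ} →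
              Typed d tN tV M τ → infer tN tV M ≡ just τ
infer-Typed (t-nt X)       = refl
infer-Typed (t-var y)      = refl
infer-Typed (t-node _ _ _) = refl
infer-Typed (t-app tK tL) rewrite infer-Typed tK = refl

ordArity-ords : ∀ m → ordArity (ords m) ≡ just m
ordArity-ords zero    = refl
ordArity-ords (suc m) rewrite ordArity-ords m = refl

tr-app-ords : ∀ {d} {N V : Set} {tN : N → Ty} {tV : V → Ty} {m K} → Typed d tN tV K (ords (suc m)) →
              ∀ A Zo L → tr d tN tV A Zo (app K L) ≡
                         gadget d (λ r → tr d tN tV (A ++ r ∷ []) Zo K)
                                  (λ r → tr d tN tV [] (λ y → mmap (restr r) (Zo y)) L)
tr-app-ords {m = m} tyK A Zo L rewrite infer-Typed tyK | ordArity-ords m = refl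

module _ (R : RS) {W : Set} (d : ℕ) where
  open RS R using (NT)

  module _ {V : Set} {m} (Zf : V ⊎ Fin m → ℕ) (S : ETree (V ⊎ Fin (suc m))) (U : ETree V)
           (Kt Lt : ℕ → Term NT W)
           (hK : ∀ r → InD d r → IsBT R (Kt r) (trtB d Zf (r ∷ []) (bindT S)))
           (hL : ∀ r → InD d r → IsBT R (Lt r) (trtB d (λ y → restr r (Zf y)) [] (mapE inj₁ U))) where

    length-gadget : length (choices (adamNode Kt Lt) (Kt (2 * d)) id d) ≡ suc d
    length-gadget = length-choices (adamNode Kt Lt) (Kt (2 * d)) id d

    IsBT-adam-branch : ∀ {i} → i < d → ∀ π →
                       BTat R (adamNode Kt Lt (suc i)) π (trtB d Zf [] (sub1 S U) (i ∷ π))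
    IsBT-adam-branch {i} i<d π with i <ᵇ d | <⇒<ᵇ i<d
    ... | true | _ with π
    ...   | []                   = at-node ε
    ...   | zero ∷ π′            = at-child ε (s≤s z≤n) (hK (suc i) (inj₁ (s≤s z≤n , i<d)) π′)
    ...   | suc zero ∷ []        = at-child ε (s≤s (s≤s z≤n)) (at-node ε)
    ...   | suc zero ∷ zero ∷ π″ =
            at-child ε (s≤s (s≤s z≤n)) (at-child ε (s≤s z≤n) (hL (suc i) (inj₁ (s≤s z≤n , i<d)) π″))
    ...   | suc zero ∷ suc _ ∷ _ = at-child ε (s≤s (s≤s z≤n)) (at-out ε (s≤s z≤n))
    ...   | suc (suc _) ∷ _      = at-out ε (s≤s (s≤s z≤n))

    IsBT-last-branch : ∀ π → BTat R (Kt (2 * d)) π (trtB d Zf [] (sub1 S U) (d ∷ π))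
    IsBT-last-branch π with d <ᵇ d | <ᵇ⇒< d d | d ≡ᵇ d | ≡⇒≡ᵇ d d refl
    ... | true  | d<d | _     | _ = ⊥-elim (<-irrefl refl (d<d tt))
    ... | false | _   | true  | _ = hK (2 * d) (inj₂ refl) π

    IsBT-gadget-out : ∀ {i} → d < i → ∀ π →
                      BTat R (gadget d Kt Lt) (i ∷ π) (trtB d Zf [] (sub1 S U) (i ∷ π))
    IsBT-gadget-out {i} d<i π with i <ᵇ d | <ᵇ⇒< i d | i ≡ᵇ d | ≡ᵇ⇒≡ i d
    ... | true  | i<d | _     | _   = ⊥-elim (<-asym (i<d tt) d<i)
    ... | false | _   | true  | i≡d = ⊥-elim (<-irrefl (sym (i≡d tt)) d<i)
    ... | false | _   | false | _   =
          at-out ε (≡-subst (_≤ i) (sym length-gadget) d<i)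

    IsBT-gadget : IsBT R (gadget d Kt Lt) (trt d Zf (sub1 S U))
    IsBT-gadget [] = ≡-subst (λ k → BTat R (gadget d Kt Lt) [] (nd (Eve , 1) k)) length-gadget (at-node ε)
    IsBT-gadget (i ∷ π) with <-cmp i d
    ... | tri< i<d _ _ =
          at-child ε q (≡-subst (λ M → BTat R M π _) (sym (lookup-choices-< _ _ id d q i<d))
                         (IsBT-adam-branch i<d π))
      where q = ≡-subst (i <_) (sym length-gadget) (m≤n⇒m≤1+n i<d)
    ... | tri≈ _ refl _ =
          at-child ε q (≡-subst (λ M → BTat R M π _) (sym (lookup-choices-last _ _ id d q))
                         (IsBT-last-branch π))
      where q = ≡-subst (d <_) (sym length-gadget) (n<1+n d)
    ... | tri> _ _ d<i = IsBT-gadget-out d<i π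

module _ (d : ℕ) (G : Scheme d) {𝒵 : Set} (Z : 𝒵 → ℕ) where
  open Scheme G using (n; tp)

  trG : List ℕ → (𝒵 → ℕ) → Term (Fin n) 𝒵 → Term (NT† (Fin n)) (𝒵 × List ℕ)
  trG A Z′ = tr d tp (λ _ → o) A (λ y → just (Z′ y))

  ArgAgrees : Term (Fin n) 𝒵 → ETree 𝒵 → Set
  ArgAgrees L U = ∀ r → InD d r →
    IsBT (dagRS G) (trG [] (λ y → restr r (Z y)) L) (trt d (λ y → restr r (Z y)) U)

  HeadAgrees : ∀ m → Term (Fin n) 𝒵 → ETree (𝒵 ⊎ Fin m) → Set
  HeadAgrees m K S = ∀ (A : Vec ℕ m) → (∀ j → InD d (lookup A j)) →
    IsBT (dagRS G) (trG (toList A) Z K) (trt d (updZ Z A) S)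

  HeadAgrees-app : ∀ {m K} → Typed d tp (λ _ → o) K (ords (suc m)) → ∀ L S U → Scoped 0 S →
                   ArgAgrees L U → HeadAgrees (suc m) K S → HeadAgrees m (app K L) (sub1 S U)
  HeadAgrees-app {m} {K} tyK L S U scS agreeL agreeK A inA π =
    ≡-subst (λ M → BTat (dagRS G) M π _) (sym (tr-app-ords tyK (toList A) (λ y → just (Z y)) L))
      (IsBT-gadget (dagRS G) d (updZ Z A) S U _ _ headBranch argBranch π)
    where
    headBranch : ∀ r → InD d r → IsBT (dagRS G) (trG (toList A ++ r ∷ []) Z K)
                                             (trtB d (updZ Z A) (r ∷ []) (bindT S))
    headBranch r inr π =
      subst₂ (λ B l → BTat (dagRS G) (trG B Z K) π l) (toList-∷ʳ r A)
        (sym (trtB-bind d (updZ Z A) (updZ Z (A ∷ʳ r)) r (extend-updZ Z A r) [] _ refl 0 refl S (bindT S)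
               (bindT≡bindL S) scS π))
        (agreeK (A ∷ʳ r) (∀-lookup-∷ʳ (InD d) A r inA inr) π)
    argBranch : ∀ r → InD d r → IsBT (dagRS G) (trG [] (λ y → restr r (Z y)) L)
                                  (trtB d (λ y → restr r (updZ Z A y)) [] (mapE inj₁ U))
    argBranch r inr π =
      ≡-subst (BTat (dagRS G) _ π)
        (sym (trtB-relabel d inj₁ _ _ (λ _ → refl) [] U (mapE inj₁ U) (mapE≡mapL inj₁ U) π))
        (agreeL r inr π)

  IsBT-apps-substs : ∀ m K → Typed d tp (λ _ → o) K (ords m) →
                     (Ls : Fin m → Term (Fin n) 𝒵) → (∀ i → Typed d tp (λ _ → o) (Ls i) o) →
                     (S : ETree (𝒵 ⊎ Fin m)) → Scoped 0 S →
                     (Us : Fin m → ETree 𝒵) → (∀ i → Scoped 0 (Us i)) →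
                     (∀ i → ArgAgrees (Ls i) (Us i)) → HeadAgrees m K S →
                     IsBT (dagRS G) (trG [] Z (apps K (tabulate Ls))) (trt d Z (substs m S Us))
  IsBT-apps-substs zero K _ Ls _ S _ Us _ _ agreeK π =
    ≡-subst (BTat (dagRS G) _ π)
      (sym (trtB-relabel d noFin0 Z (updZ Z []ᵥ) noFin0-updZ [] S (mapE noFin0 S) (mapE≡mapL noFin0 S) π))
      (agreeK []ᵥ (λ ()) π)
    where
    noFin0-updZ : ∀ y → Z (noFin0 y) ≡ updZ Z []ᵥ y
    noFin0-updZ (inj₁ x) = refl
  IsBT-apps-substs (suc m) K tyK Ls tyLs S scS Us scUs agreeLs agreeK =
    IsBT-apps-substs m (app K (Ls zero)) (t-app tyK (tyLs zero)) (λ i → Ls (suc i)) (λ i → tyLs (suc i))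
      (sub1 S (Us zero)) (Scoped-sub1 S (Us zero) scS (scUs zero)) (λ i → Us (suc i)) (λ i → scUs (suc i))
      (λ i → agreeLs (suc i)) (HeadAgrees-app tyK (Ls zero) S (Us zero) scS (agreeLs zero) agreeK)

-- Neither the parity of G nor Z taking values in D_d is needed: the identity is purely syntactic.
lemmaD1 : (d : ℕ) (G : Scheme d) → IsParity G →
    (𝒵 : Set) (ℓ : ℕ) (Z : 𝒵 → ℕ) → (∀ z → InD d (Z z)) →
    (N : Term (Fin (Scheme.n G)) 𝒵) → Typed d (Scheme.tp G) (λ _ → o) N (ords ℓ) →
    (L : Fin ℓ → Term (Fin (Scheme.n G)) 𝒵) →
    (∀ i → Typed d (Scheme.tp G) (λ _ → o) (L i) o) →
    (T : ETree (𝒵 ⊎ Fin ℓ)) → ETOk d T →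
    (U : Fin ℓ → ETree 𝒵) → (∀ i → ETOk d (U i)) →
    (∀ i r → InD d r →
       IsBT (dagRS G)
         (tr d (Scheme.tp G) (λ _ → o) [] (λ y → just (restr r (Z y))) (L i))
         (trt d (λ y → restr r (Z y)) (U i))) →
    (∀ (A : Vec ℕ ℓ) → (∀ j → InD d (lookup A j)) →
       IsBT (dagRS G)
         (tr d (Scheme.tp G) (λ _ → o) (toList A) (λ y → just (Z y)) N)
         (trt d (updZ Z A) T)) →
    IsBT (dagRS G)
      (tr d (Scheme.tp G) (λ _ → o) [] (λ y → just (Z y)) (apps N (tabulate L)))
      (trt d Z (substs ℓ T U))
lemmaD1 d G _ 𝒵 ℓ Z _ N tyN L tyL T okT U okU agreeL agreeN =
  IsBT-apps-substs d G Z ℓ N tyN L tyL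
    T (ETOk⇒Scoped d T okT) U (λ i → ETOk⇒Scoped d (U i) (okU i)) agreeL agreeN
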